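{- Let $n\ge 1$ and $\alpha=\beta=1$. For any $\mathcal{C}\in\{\bullet,\circ\}^n$ and any $T\in R^{ -1}\{\mathcal{C}\}$, $$\sum_{\mathcal{C}'}W(\mathcal{C}\to\mathcal{C}')=|f^{ -1}\{T\}|.$$ Consequently, for any $\mathcal{C}\in\{\bullet,\circ\}^n$, $$|R^{ -1}\{\mathcal{C}\}|\sum_{\mathcal{C}'}W(\mathcal{C}\to\mathcal{C}')=|(R\circ f)^{ -1}\{\mathcal{C}\}|.$$
   Context: Configurations are strings $\mathcal{C}\in\{\bullet,\circ\}^n$. With $\alpha=\beta=1$: $W(\mathcal{C}\to\mathcal{C}')=1$ if $\mathcal{C}=\circ\mathcal{A},\mathcal{C}'=\bullet\mathcal{A}$, or $\mathcal{C}=\mathcal{A}\bullet,\mathcal{C}'=\mathcal{A}\circ$, or $\mathcal{C}=\mathcal{A}\bullet\circ\mathcal{A}',\mathcal{C}'=\mathcal{A}\circ\bullet\mathcal{A}'$ ($\mathcal{A},\mathcal{A}'$ arbitrary, possibly empty strings); otherwise $W=0$. A plane binary tree is a rooted tree in which every vertex is either an endpoint (leaf) or has exactly two children, an ordered left child and right child. $\mathcal{T}_n$ is the set of plane binary trees with $n+2$ endpoints, ordered left to right. A non-root vertex is a left (resp. right) descendent if it is the left (resp. right) child of its parent. $R:\mathcal{T}_n\to\{\bullet,\circ\}^n$ sends $T$ to $(t_1,\dots,t_n)$ with $t_k=\bullet$ if the $(k+1)$-th endpoint from the left is a left descendent and $t_k=\circ$ otherwise. A last branching vertex of a tree is a non-endpoint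 vertex both of whose children are endpoints. A marked tree is a pair $(T,v)$ with $T\in\mathcal{T}_n$ and $v$ one of the last branching vertices of $T$; $\widehat{\mathcal{T}}_n$ is the set of marked trees, and $f:\widehat{\mathcal{T}}_n\to\mathcal{T}_n$, $f(T,v)=T$, forgets the marking (so $|f^{ -1}\{T\}|$ is the number of last branching vertices of $T$). -}

module Defs where

open import Data.Nat using (ℕ; zero; suc; _+_)
open import Data.Bool using (Bool; true; false; _∧_; _∨_; if_then_else_)
open import Data.Vec using (Vec; []; _∷_; _++_; tail; init; last)
open import Data.Vec.Properties using (≡-dec)
open import Data.List using (List; []; _∷_; map) renaming (_++_ to _++ᴸ_)
open import Data.Nat.ListAction using (sum)
open import Data.Product using (Σ; _,_; proj₁)
open import Relation.Nullary using (does)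
open import Relation.Binary.PropositionalEquality using (_≡_; refl; subst)
open import Relation.Binary using (DecidableEquality)

data Site : Set where
  ● ○ : Site

_≟ˢ_ : DecidableEquality Site
● ≟ˢ ● = Relation.Nullary.yes refl
● ≟ˢ ○ = Relation.Nullary.no (λ ())
○ ≟ˢ ● = Relation.Nullary.no (λ ())
○ ≟ˢ ○ = Relation.Nullary.yes refl

Config : ℕ → Set
Config n = Vec Site n

_==_ : ∀ {n} → Config n → Config n → Bool
A == A' = does (≡-dec _≟ˢ_ A A')

_=ˢ_ : Site → Site → Bool
x =ˢ y = does (x ≟ˢ y)

allConfigs : (n : ℕ) → List (Config n)
allConfigs zero    = [] ∷ []
allConfigs (suc n) = map (● ∷_) (allConfigs n) ++ᴸ map (○ ∷_) (allConfigs n)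

-- Transition rates with α = β = 1

enter : ∀ {n} → Config n → Config n → Bool
enter (○ ∷ A) (● ∷ A') = A == A'
enter _ _ = false

exit : ∀ {n} → Config n → Config n → Bool
exit {zero}  _ _  = false
exit {suc n} C C' = (last C =ˢ ●) ∧ (last C' =ˢ ○) ∧ (init C == init C')

-- C = A●○A' , C' = A○●A'
hop : ∀ {n} → Config n → Config n → Bool
hop (x ∷ y ∷ A) (x' ∷ y' ∷ A') =
  ((x =ˢ ●) ∧ (y =ˢ ○) ∧ (x' =ˢ ○) ∧ (y' =ˢ ●) ∧ (A == A'))
  ∨ ((x =ˢ x') ∧ hop (y ∷ A) (y' ∷ A'))
hop _ _ = false

W : ∀ {n} → Config n → Config n → ℕ
W C C' = if enter C C' ∨ exit C C' ∨ hop C C' then 1 else 0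

totalRate : ∀ {n} → Config n → ℕ
totalRate {n} C = sum (map (W C) (allConfigs n))

data Tree : Set where
  leaf : Tree
  node : Tree → Tree → Tree

endpoints : Tree → ℕ
endpoints leaf       = 1
endpoints (node l r) = endpoints l + endpoints r

𝒯 : ℕ → Set
𝒯 n = Σ Tree (λ t → endpoints t ≡ 2 + n)

-- The Site argument records whether the current
-- vertex is a left descendent (●) or not (○; right child or root).
endpointLabels : Site → (t : Tree) → Vec Site (endpoints t)
endpointLabels s leaf       = s ∷ []
endpointLabels s (node l r) = endpointLabels ● l ++ endpointLabels ○ r

R : ∀ {n} → 𝒯 n → Config n
R {n} (t , p) = init (tail (subst (Vec Site) p (endpointLabels ○ t)))

data LastBranching : Tree → Set where
  here : LastBranching (node leaf leaf)
  inL  : ∀ {l r} → LastBranching l → LastBranching (node l r)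
  inR  : ∀ {l r} → LastBranching r → LastBranching (node l r)

Marked : ℕ → Set
Marked n = Σ (𝒯 n) (λ T → LastBranching (proj₁ T))

f : ∀ {n} → Marked n → 𝒯 n
f (T , v) = T

R⁻¹ : ∀ {n} → Config n → Set
R⁻¹ {n} C = Σ (𝒯 n) (λ T → R T ≡ C)

f⁻¹ : ∀ {n} → 𝒯 n → Set
f⁻¹ {n} T = Σ (Marked n) (λ M → f M ≡ T)

Rf⁻¹ : ∀ {n} → Config n → Set
Rf⁻¹ {n} C = Σ (Marked n) (λ M → R (f M) ≡ C)

-- Summed over C', the rate W(C → C') counts the adjacent pairs ●○ in the
-- word ●C○: the leading ● pairs with an initial ○ (entry), the trailing ○
-- with a final ● (exit), and every internal ●○ allows one hop.  The endpoint
-- labels of a tree T ∈ R⁻¹{C} read exactly ●C○, and two consecutive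
-- endpoints labelled ●○ (a left child followed by a right child) are always
-- siblings, i.e. the children of a last branching vertex.  So every tree in
-- R⁻¹{C} carries totalRate C markings, and the second identity follows by
-- counting marked trees fibrewise.
module Submission where

open import Defs
open import Data.Nat using (ℕ; suc; _+_; _*_; _≤_; s≤s; z≤n)
open import Data.Nat.Properties using (+-comm; +-assoc; +-identityʳ)
open import Data.Bool using (Bool; true; false; _∧_; _∨_; if_then_else_)
open import Data.Bool.Properties using (∧-zeroʳ; ∨-identityʳ)
open import Data.Vec using (Vec; []; _∷_; head; tail; init; last; toList)
open import Data.Vec.Properties using (toList-++)
open import Data.List using (List; []; _∷_; map; [_]) renaming (_++_ to _++ᴸ_)
open import Data.List.Properties
  using (map-++; map-cong; map-∘; ++-assoc; ∷-injectiveˡ; ∷ʳ-injectiveʳ)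
open import Data.Nat.ListAction using (sum)
open import Data.Nat.ListAction.Properties using (sum-++)
open import Data.Product using (Σ; _×_; _,_; proj₁; proj₂)
open import Data.Sum using (_⊎_; inj₁; inj₂)
open import Data.Empty using (⊥-elim)
open import Data.Fin using (Fin)
open import Data.Fin.Properties using (+↔⊎; *↔×; 1↔⊤)
open import Data.Fin.Permutation using (↔⇒≡)
open import Data.Unit using (tt)
open import Relation.Nullary using (¬_)
open import Relation.Binary.PropositionalEquality
  using (_≡_; refl; sym; trans; cong; cong₂; subst; module ≡-Reasoning)
open import Function using (_∘_)
open import Function.Bundles using (_↔_; Inverse; mk↔ₛ′)
open import Function.Construct.Composition using (_↔-∘_)
open import Function.Construct.Symmetry using (↔-sym)
open import Function.Construct.Identity using (↔-id)
open import Data.Sum.Function.Propositional using (_⊎-↔_)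
open import Data.Product.Function.NonDependent.Propositional using (_×-↔_)

𝟙 : Bool → ℕ
𝟙 b = if b then 1 else 0

sumConfigs : ∀ {n} → (Config n → ℕ) → ℕ
sumConfigs {n} g = sum (map g (allConfigs n))

sumConfigs-∷ : ∀ {n} (g : Config (suc n) → ℕ) →
  sumConfigs g ≡ sumConfigs (g ∘ (● ∷_)) + sumConfigs (g ∘ (○ ∷_))
sumConfigs-∷ {n} g = begin
  sum (map g (map (● ∷_) A ++ᴸ map (○ ∷_) A))
    ≡⟨ cong sum (map-++ g (map (● ∷_) A) (map (○ ∷_) A)) ⟩
  sum (map g (map (● ∷_) A) ++ᴸ map g (map (○ ∷_) A))
    ≡⟨ sum-++ (map g (map (● ∷_) A)) (map g (map (○ ∷_) A)) ⟩
  sum (map g (map (● ∷_) A)) + sum (map g (map (○ ∷_) A))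
    ≡⟨ cong₂ _+_ (cong sum (sym (map-∘ A))) (cong sum (sym (map-∘ A))) ⟩
  sumConfigs (g ∘ (● ∷_)) + sumConfigs (g ∘ (○ ∷_)) ∎
  where open ≡-Reasoning
        A = allConfigs n

sumConfigs-cong : ∀ n {g h : Config n → ℕ} → (∀ D → g D ≡ h D) →
  sumConfigs g ≡ sumConfigs h
sumConfigs-cong n g≗h = cong sum (map-cong g≗h (allConfigs n))

sum-map-zero : ∀ {A : Set} (xs : List A) → sum (map (λ _ → 0) xs) ≡ 0
sum-map-zero []       = refl
sum-map-zero (_ ∷ xs) = sum-map-zero xs

sumConfigs-zero : ∀ n → sumConfigs {n} (λ _ → 0) ≡ 0
sumConfigs-zero n = sum-map-zero (allConfigs n)

sumConfigs-== : ∀ {n} (A : Config n) → sumConfigs (λ D → 𝟙 (A == D)) ≡ 1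
sumConfigs-== []      = refl
sumConfigs-== {suc n} (● ∷ A) =
  trans (sumConfigs-∷ (λ D → 𝟙 ((● ∷ A) == D))) (cong₂ _+_ (sumConfigs-== A) (sumConfigs-zero n))
sumConfigs-== {suc n} (○ ∷ A) =
  trans (sumConfigs-∷ (λ D → 𝟙 ((○ ∷ A) == D))) (cong₂ _+_ (sumConfigs-zero n) (sumConfigs-== A))

sumConfigs-head● : ∀ {n} (b : Bool) (A : Config n) →
  sumConfigs (λ D → 𝟙 (b ∧ (head D =ˢ ●) ∧ (A == tail D))) ≡ 𝟙 b
sumConfigs-head● {n} false A = sumConfigs-zero (suc n)
sumConfigs-head● {n} true  A =
  trans (sumConfigs-∷ (λ D → 𝟙 ((head D =ˢ ●) ∧ (A == tail D))))
        (cong₂ _+_ (sumConfigs-== A) (sumConfigs-zero n))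

descent : Site → Site → ℕ
descent ● ○ = 1
descent _ _ = 0

descents : List Site → ℕ
descents (x ∷ y ∷ xs) = descent x y + descents (y ∷ xs)
descents _            = 0

descents-++ : ∀ xs y ys →
  descents (xs ++ᴸ y ∷ ys) ≡ descents (xs ++ᴸ [ y ]) + descents (y ∷ ys)
descents-++ []            y ys = refl
descents-++ (x ∷ [])      y ys = cong (_+ descents (y ∷ ys)) (sym (+-identityʳ (descent x y)))
descents-++ (x ∷ x′ ∷ xs) y ys =
  trans (cong (descent x x′ +_) (descents-++ (x′ ∷ xs) y ys))
        (sym (+-assoc (descent x x′) (descents (x′ ∷ xs ++ᴸ [ y ])) (descents (y ∷ ys))))

jump : ∀ {n} → Config n → Config n → Bool
jump C C′ = exit C C′ ∨ hop C C′

jump-∷ : ∀ {n} c d d′ (A A′ : Config n) →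
  jump (c ∷ d ∷ A) (c ∷ d′ ∷ A′) ≡ jump (d ∷ A) (d′ ∷ A′)
jump-∷ ● ● _ _ _ = refl
jump-∷ ● ○ _ _ _ = refl
jump-∷ ○ ● _ _ _ = refl
jump-∷ ○ ○ _ _ _ = refl

jump-●○ : ∀ {n} d (A : Config n) (D′ : Config (suc n)) →
  jump (● ∷ d ∷ A) (○ ∷ D′) ≡ ((d =ˢ ○) ∧ (head D′ =ˢ ●) ∧ (A == tail D′))
jump-●○ d A (d′ ∷ A′) rewrite ∧-zeroʳ (last (d′ ∷ A′) =ˢ ○) | ∧-zeroʳ (last (d ∷ A) =ˢ ●) =
  ∨-identityʳ _

jump-○● : ∀ {n} (D D′ : Config (suc n)) → jump (○ ∷ D) (● ∷ D′) ≡ false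
jump-○● (d ∷ A) (d′ ∷ A′) rewrite ∧-zeroʳ (last (d′ ∷ A′) =ˢ ○) | ∧-zeroʳ (last (d ∷ A) =ˢ ●) =
  refl

sumConfigs-jump : ∀ {n} (C : Config (suc n)) →
  sumConfigs (𝟙 ∘ jump C) ≡ descents (toList C ++ᴸ [ ○ ])
sumConfigs-jump (● ∷ []) = refl
sumConfigs-jump (○ ∷ []) = refl
sumConfigs-jump {suc n} (● ∷ d ∷ A) = begin
  sumConfigs (𝟙 ∘ jump (● ∷ d ∷ A))
    ≡⟨ sumConfigs-∷ (𝟙 ∘ jump (● ∷ d ∷ A)) ⟩
  sumConfigs (𝟙 ∘ jump (● ∷ d ∷ A) ∘ (● ∷_)) + sumConfigs (𝟙 ∘ jump (● ∷ d ∷ A) ∘ (○ ∷_))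
    ≡⟨ cong₂ _+_ (sumConfigs-cong (suc n) λ { (d′ ∷ A′) → cong 𝟙 (jump-∷ ● d d′ A A′) })
                 (sumConfigs-cong (suc n) (cong 𝟙 ∘ jump-●○ d A)) ⟩
  sumConfigs (𝟙 ∘ jump (d ∷ A)) + sumConfigs (λ D′ → 𝟙 ((d =ˢ ○) ∧ (head D′ =ˢ ●) ∧ (A == tail D′)))
    ≡⟨ cong₂ _+_ (sumConfigs-jump (d ∷ A)) (sumConfigs-head● (d =ˢ ○) A) ⟩
  descents (d ∷ toList A ++ᴸ [ ○ ]) + 𝟙 (d =ˢ ○)
    ≡⟨ swap d ⟩
  descent ● d + descents (d ∷ toList A ++ᴸ [ ○ ]) ∎
  where
  open ≡-Reasoning
  swap : ∀ d → descents (d ∷ toList A ++ᴸ [ ○ ]) + 𝟙 (d =ˢ ○)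
             ≡ descent ● d + descents (d ∷ toList A ++ᴸ [ ○ ])
  swap ● = +-identityʳ _
  swap ○ = +-comm _ 1
sumConfigs-jump {suc n} (○ ∷ d ∷ A) = begin
  sumConfigs (𝟙 ∘ jump (○ ∷ d ∷ A))
    ≡⟨ sumConfigs-∷ (𝟙 ∘ jump (○ ∷ d ∷ A)) ⟩
  sumConfigs (𝟙 ∘ jump (○ ∷ d ∷ A) ∘ (● ∷_)) + sumConfigs (𝟙 ∘ jump (○ ∷ d ∷ A) ∘ (○ ∷_))
    ≡⟨ cong₂ _+_ (sumConfigs-cong (suc n) (cong 𝟙 ∘ jump-○● (d ∷ A)))
                 (sumConfigs-cong (suc n) λ { (d′ ∷ A′) → cong 𝟙 (jump-∷ ○ d d′ A A′) }) ⟩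
  sumConfigs {suc n} (λ _ → 0) + sumConfigs (𝟙 ∘ jump (d ∷ A))
    ≡⟨ cong₂ _+_ (sumConfigs-zero (suc n)) (sumConfigs-jump (d ∷ A)) ⟩
  descents (d ∷ toList A ++ᴸ [ ○ ]) ∎
  where open ≡-Reasoning

totalRate≡descents : ∀ {n} (C : Config (suc n)) →
  totalRate C ≡ descents (● ∷ toList C ++ᴸ [ ○ ])
totalRate≡descents (● ∷ []) = refl
totalRate≡descents (○ ∷ []) = refl
totalRate≡descents {suc n} (● ∷ d ∷ A) =
  trans (sumConfigs-cong (suc (suc n)) λ { (_ ∷ _) → refl }) (sumConfigs-jump (● ∷ d ∷ A))
totalRate≡descents {suc n} (○ ∷ d ∷ A) =
  trans (sumConfigs-∷ (W (○ ∷ d ∷ A)))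
    (cong₂ _+_
      (trans (sumConfigs-cong (suc n) λ D′ → cong (𝟙 ∘ ((d ∷ A) == D′ ∨_)) (jump-○● (d ∷ A) D′))
        (trans (sumConfigs-cong (suc n) λ D′ → cong 𝟙 (∨-identityʳ ((d ∷ A) == D′)))
               (sumConfigs-== (d ∷ A))))
      (trans (sumConfigs-cong (suc n) λ { (d′ ∷ A′) → cong 𝟙 (jump-∷ ○ d d′ A A′) })
             (sumConfigs-jump (d ∷ A))))

labels : Site → Tree → List Site
labels s leaf       = s ∷ []
labels s (node l r) = labels ● l ++ᴸ labels ○ r

toList-endpointLabels : ∀ s t → toList (endpointLabels s t) ≡ labels s t
toList-endpointLabels s leaf       = refl
toList-endpointLabels s (node l r) =
  trans (toList-++ (endpointLabels ● l) (endpointLabels ○ r))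
        (cong₂ _++ᴸ_ (toList-endpointLabels ● l) (toList-endpointLabels ○ r))

firstLabel : Site → Tree → Site
firstLabel s leaf       = s
firstLabel s (node _ _) = ●

lastLabel : Site → Tree → Site
lastLabel s leaf       = s
lastLabel s (node _ _) = ○

firstLabel-● : ∀ t → firstLabel ● t ≡ ●
firstLabel-● leaf       = refl
firstLabel-● (node _ _) = refl

lastLabel-○ : ∀ t → lastLabel ○ t ≡ ○
lastLabel-○ leaf       = refl
lastLabel-○ (node _ _) = refl

labels-∷ : ∀ s t → Σ (List Site) λ bs → labels s t ≡ firstLabel s t ∷ bs
labels-∷ s leaf       = [] , refl
labels-∷ s (node l r) with labels-∷ ● l
... | bs , eq = bs ++ᴸ labels ○ r ,
  trans (cong (_++ᴸ labels ○ r) eq) (cong (λ x → x ∷ bs ++ᴸ labels ○ r) (firstLabel-● l))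

labels-∷ʳ : ∀ s t → Σ (List Site) λ as → labels s t ≡ as ++ᴸ [ lastLabel s t ]
labels-∷ʳ s leaf       = [] , refl
labels-∷ʳ s (node l r) with labels-∷ʳ ○ r
... | as , eq = labels ● l ++ᴸ as ,
  trans (cong (labels ● l ++ᴸ_) (trans eq (cong (λ x → as ++ᴸ [ x ]) (lastLabel-○ r))))
        (sym (++-assoc (labels ● l) as [ ○ ]))

-- The junction term is 1 exactly when both subtrees are leaves.
cherries : Tree → ℕ
cherries leaf       = 0
cherries (node l r) = descent (lastLabel ● l) (firstLabel ○ r) + cherries l + cherries r

descents-labels : ∀ s t → descents (labels s t) ≡ cherries t
descents-labels s leaf       = refl
descents-labels s (node l r) with labels-∷ʳ ● l | labels-∷ ○ r
... | as , eqˡ | bs , eqʳ = begin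
  descents (labels ● l ++ᴸ labels ○ r)
    ≡⟨ cong₂ (λ xs ys → descents (xs ++ᴸ ys)) eqˡ eqʳ ⟩
  descents ((as ++ᴸ [ a ]) ++ᴸ b ∷ bs)
    ≡⟨ cong descents (++-assoc as [ a ] (b ∷ bs)) ⟩
  descents (as ++ᴸ a ∷ b ∷ bs)
    ≡⟨ descents-++ as a (b ∷ bs) ⟩
  descents (as ++ᴸ [ a ]) + (descent a b + descents (b ∷ bs))
    ≡⟨ cong₂ (λ x y → x + (descent a b + y))
             (trans (cong descents (sym eqˡ)) (descents-labels ● l))
             (trans (cong descents (sym eqʳ)) (descents-labels ○ r)) ⟩
  cherries l + (descent a b + cherries r)
    ≡⟨ sym (+-assoc (cherries l) (descent a b) (cherries r)) ⟩
  cherries l + descent a b + cherries r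
    ≡⟨ cong (_+ cherries r) (+-comm (cherries l) (descent a b)) ⟩
  descent a b + cherries l + cherries r ∎
  where
  open ≡-Reasoning
  a = lastLabel ● l
  b = firstLabel ○ r

LastBranching-node↔⊎ : ∀ l r → ¬ (l ≡ leaf × r ≡ leaf) →
  LastBranching (node l r) ↔ (LastBranching l ⊎ LastBranching r)
LastBranching-node↔⊎ l r not-cherry = mk↔ₛ′ to from to∘from from∘to
  where
  to : LastBranching (node l r) → LastBranching l ⊎ LastBranching r
  to here    = ⊥-elim (not-cherry (refl , refl))
  to (inL v) = inj₁ v
  to (inR v) = inj₂ v
  from : LastBranching l ⊎ LastBranching r → LastBranching (node l r)
  from (inj₁ v) = inL v
  from (inj₂ v) = inR v
  to∘from : ∀ v → to (from v) ≡ v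
  to∘from (inj₁ _) = refl
  to∘from (inj₂ _) = refl
  from∘to : ∀ v → from (to v) ≡ v
  from∘to here    = ⊥-elim (not-cherry (refl , refl))
  from∘to (inL _) = refl
  from∘to (inR _) = refl

LastBranching↔cherries : ∀ t → LastBranching t ↔ Fin (cherries t)
LastBranching↔cherries leaf = mk↔ₛ′ (λ ()) (λ ()) (λ ()) (λ ())
LastBranching↔cherries (node leaf leaf) =
  ↔-sym 1↔⊤ ↔-∘ mk↔ₛ′ (λ _ → tt) (λ _ → here) (λ _ → refl) (λ { here → refl })
LastBranching↔cherries (node leaf r@(node _ _)) =
  ↔-sym (+↔⊎ {0}) ↔-∘ ((LastBranching↔cherries leaf ⊎-↔ LastBranching↔cherries r)
    ↔-∘ LastBranching-node↔⊎ leaf r λ { (_ , ()) })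
LastBranching↔cherries (node l@(node _ _) r) =
  ↔-sym (+↔⊎ {cherries l}) ↔-∘ ((LastBranching↔cherries l ⊎-↔ LastBranching↔cherries r)
    ↔-∘ LastBranching-node↔⊎ l r λ { (() , _) })

toList-subst : ∀ {A : Set} {m n} (eq : m ≡ n) (v : Vec A m) →
  toList (subst (Vec A) eq v) ≡ toList v
toList-subst refl v = refl

toList-init-last : ∀ {A : Set} {n} (v : Vec A (suc n)) →
  toList v ≡ toList (init v) ++ᴸ [ last v ]
toList-init-last (x ∷ [])     = refl
toList-init-last (x ∷ y ∷ ys) = cong (x ∷_) (toList-init-last (y ∷ ys))

toList-head-init-last : ∀ {A : Set} {n} (v : Vec A (suc (suc n))) →
  toList v ≡ head v ∷ toList (init (tail v)) ++ᴸ [ last (tail v) ]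
toList-head-init-last (x ∷ w) = cong (x ∷_) (toList-init-last w)

labels≡●R○ : ∀ {n} (T : 𝒯 n) → labels ○ (proj₁ T) ≡ ● ∷ toList (R T) ++ᴸ [ ○ ]
labels≡●R○ (leaf , ())
labels≡●R○ (t@(node _ _) , eq) =
  trans ls≡v (cong₂ (λ x y → x ∷ toList (init (tail v)) ++ᴸ [ y ]) head≡● last≡○)
  where
  v = subst (Vec Site) eq (endpointLabels ○ t)
  ls≡v : labels ○ t ≡ head v ∷ toList (init (tail v)) ++ᴸ [ last (tail v) ]
  ls≡v = trans (sym (toList-endpointLabels ○ t))
    (trans (sym (toList-subst eq _)) (toList-head-init-last v))
  head≡● : head v ≡ ●
  head≡● = ∷-injectiveˡ (trans (sym ls≡v) (proj₂ (labels-∷ ○ t)))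
  last≡○ : last (tail v) ≡ ○
  last≡○ = ∷ʳ-injectiveʳ (head v ∷ toList (init (tail v))) (proj₁ (labels-∷ʳ ○ t))
    (trans (sym ls≡v) (proj₂ (labels-∷ʳ ○ t)))

cherries≡totalRate : ∀ {n} (T : 𝒯 (suc n)) → cherries (proj₁ T) ≡ totalRate (R T)
cherries≡totalRate T = begin
  cherries (proj₁ T)                     ≡⟨ sym (descents-labels ○ (proj₁ T)) ⟩
  descents (labels ○ (proj₁ T))          ≡⟨ cong descents (labels≡●R○ T) ⟩
  descents (● ∷ toList (R T) ++ᴸ [ ○ ])  ≡⟨ sym (totalRate≡descents (R T)) ⟩
  totalRate (R T)                        ∎
  where open ≡-Reasoning

LastBranching↔totalRate : ∀ {n} {C : Config (suc n)} (T : 𝒯 (suc n)) → R T ≡ C →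
  LastBranching (proj₁ T) ↔ Fin (totalRate C)
LastBranching↔totalRate {C = C} T RT≡C =
  subst (λ k → LastBranching (proj₁ T) ↔ Fin k) (trans (cherries≡totalRate T) (cong totalRate RT≡C))
    (LastBranching↔cherries (proj₁ T))

f⁻¹↔LastBranching : ∀ {n} (T : 𝒯 n) → f⁻¹ T ↔ LastBranching (proj₁ T)
f⁻¹↔LastBranching T = mk↔ₛ′ to from (λ _ → refl) from∘to
  where
  to : f⁻¹ T → LastBranching (proj₁ T)
  to ((_ , v) , eq) = subst (LastBranching ∘ proj₁) eq v
  from : LastBranching (proj₁ T) → f⁻¹ T
  from v = (T , v) , refl
  from∘to : ∀ M → from (to M) ≡ M
  from∘to ((_ , _) , refl) = refl

Rf⁻¹↔R⁻¹×totalRate : ∀ {n} (C : Config (suc n)) → Rf⁻¹ C ↔ (R⁻¹ C × Fin (totalRate C))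
Rf⁻¹↔R⁻¹×totalRate C = mk↔ₛ′ to from to∘from from∘to
  where
  to : Rf⁻¹ C → R⁻¹ C × Fin (totalRate C)
  to ((T , v) , eq) = (T , eq) , Inverse.to (LastBranching↔totalRate T eq) v
  from : R⁻¹ C × Fin (totalRate C) → Rf⁻¹ C
  from ((T , eq) , i) = (T , Inverse.from (LastBranching↔totalRate T eq) i) , eq
  to∘from : ∀ p → to (from p) ≡ p
  to∘from ((T , eq) , i) = cong ((T , eq) ,_) (Inverse.strictlyInverseˡ (LastBranching↔totalRate T eq) i)
  from∘to : ∀ M → from (to M) ≡ M
  from∘to ((T , v) , eq) = cong (λ w → (T , w) , eq) (Inverse.strictlyInverseʳ (LastBranching↔totalRate T eq) v)

lemma1 : (n : ℕ) → 1 ≤ n → (C : Config n) →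
    ((T : 𝒯 n) → R T ≡ C → f⁻¹ T ↔ Fin (totalRate C))
    × ((k m : ℕ) → R⁻¹ C ↔ Fin k → Rf⁻¹ C ↔ Fin m → k * totalRate C ≡ m)
lemma1 (suc n) (s≤s z≤n) C =
  (λ T RT≡C → LastBranching↔totalRate T RT≡C ↔-∘ f⁻¹↔LastBranching T) ,
  (λ k m R⁻¹↔k Rf⁻¹↔m → ↔⇒≡
    (Rf⁻¹↔m ↔-∘ (↔-sym (Rf⁻¹↔R⁻¹×totalRate C) ↔-∘ ((↔-sym R⁻¹↔k ×-↔ ↔-id _) ↔-∘ *↔× {k}))))
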